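{- Let $M=x^2+x+1\in\mathbb{F}_2[x]$, $u\ge1$, $v\ge1$, and $A=(M^{2v}+\cdots+M+1)^{2^u}$. Let $r$ be the least integer such that $2v<2^r$. Then $\ell_A=2^u(2^r-2v-1)+1$.
   Context: For nonzero $A\in\mathbb{F}_2[x]$, the Collatz transformations are: $A_0=A$, and for $k\ge0$, $A_{2k+1}=A_{2k}/(x^{a_{2k}}(x+1)^{b_{2k}})$ where $a_{2k},b_{2k}$ are the multiplicities of $x$ and $x+1$ in $A_{2k}$, and $A_{2k+2}=1+MA_{2k+1}$. The length $\ell_A$ is $1+\min\{k\ge0: A_{2k+1}=1\}$, i.e. the number of terms of the sequence $A_1,A_3,A_5,\dots$ up to and including its first term equal to $1$. -}

module Defs where

open import Data.Bool using (Bool; true; false; _xor_; if_then_else_)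
open import Data.List using (List; []; _∷_; length)
open import Data.Nat using (ℕ; zero; suc; _<_)
open import Data.Product using (∃-syntax; _×_)
open import Relation.Binary.PropositionalEquality using (_≡_)
open import Relation.Nullary using (¬_)

-- Polynomials over F₂ as coefficient lists, constant term first.
-- Lists may carry trailing zero coefficients; `normalize` strips them,
-- and equality of polynomials is equality of normalized lists.
Poly : Set
Poly = List Bool

normalize : Poly → Poly
normalize [] = []
normalize (a ∷ p) with normalize p
... | [] = if a then true ∷ [] else []
... | q@(_ ∷ _) = a ∷ q

one : Poly
one = true ∷ []

_⊕_ : Poly → Poly → Poly
[] ⊕ q = q
(a ∷ p) ⊕ [] = a ∷ p
(a ∷ p) ⊕ (b ∷ q) = (a xor b) ∷ (p ⊕ q)

infixl 6 _⊕_
infixl 7 _⊗_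

_⊗_ : Poly → Poly → Poly
[] ⊗ q = []
(a ∷ p) ⊗ q = (if a then q else []) ⊕ (false ∷ (p ⊗ q))

_^ᵖ_ : Poly → ℕ → Poly
p ^ᵖ zero = one
p ^ᵖ suc n = p ⊗ (p ^ᵖ n)

M : Poly
M = true ∷ true ∷ true ∷ []

geomSum : Poly → ℕ → Poly
geomSum p zero = one
geomSum p (suc n) = (p ^ᵖ suc n) ⊕ geomSum p n

stripX : Poly → Poly
stripX [] = []
stripX (false ∷ p) = stripX p
stripX (true ∷ p) = true ∷ p

eval1 : Poly → Bool
eval1 [] = false
eval1 (a ∷ p) = a xor eval1 p

-- quotient of p by (x+1), assuming (x+1) ∣ p (synthetic division):
-- q_i = p_0 + ⋯ + p_i, last coefficient dropped
divX1-aux : Bool → Poly → Poly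
divX1-aux s [] = []
divX1-aux s (a ∷ []) = []
divX1-aux s (a ∷ b ∷ p) = (s xor a) ∷ divX1-aux (s xor a) (b ∷ p)

divX1 : Poly → Poly
divX1 p = divX1-aux false p

stripX1-fuel : ℕ → Poly → Poly
stripX1-fuel zero p = p
stripX1-fuel (suc n) [] = []
stripX1-fuel (suc n) (a ∷ p) with eval1 (a ∷ p)
... | true = a ∷ p
... | false = stripX1-fuel n (normalize (divX1 (a ∷ p)))

-- A / (x^a (x+1)^b) with a, b the multiplicities of x and x+1 in A
oddPart : Poly → Poly
oddPart p = let q = stripX (normalize p) in stripX1-fuel (length q) q

-- Collatz sequence: odd A k = A_{2k+1}
--   A_1 = oddPart A,  A_{2k+3} = oddPart (1 + M A_{2k+1})
odd : Poly → ℕ → Poly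
odd A zero = oddPart A
odd A (suc k) = oddPart (one ⊕ M ⊗ odd A k)

IsOne : Poly → Set
IsOne p = normalize p ≡ one

-- ℓ_A = L  iff  L = 1 + min{k : A_{2k+1} = 1}
CollatzLength : Poly → ℕ → Set
CollatzLength A L =
  ∃[ m ] (L ≡ suc m × IsOne (odd A m) × (∀ k → k < m → ¬ IsOne (odd A k)))

-- Substituting t = x² + x = x(x + 1) maps 1 + t to M, so A = φ(b) with
-- b = ((1 + t)^(2v) + ⋯ + 1)^(2^u), and t^(2^u) b = (1 + t)^((2v+1) 2^u) + 1 by telescoping and
-- Frobenius. Since φ(tᵏ c) = xᵏ (x + 1)ᵏ φ(c), and φ(c) is prime to x(x + 1) exactly when c(0) = 1,
-- the Collatz sequence of A is the image under φ of c ↦ (1 + (1 + t) c) / tᵏ in F₂[t]. By Pascal's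
-- rule this map sends a tail Σᵢ C(m, e + i) tⁱ of (1 + t)^m with C(m, e) odd (coefficients mod 2) to
-- the tail of (1 + t)^(m+1) at the least e′ > e with C(m + 1, e′) odd; the tail is 1 exactly when
-- e = m. We start at m = (2v+1) 2^u, e = 2^u. With 2^a = 2^(u+r−1) ≤ m < 2^(a+1), C(m, m − 2^a) is
-- odd (Lucas), which keeps e ≤ m − 2^a until m reaches 2^(a+1); there all C(2^(a+1), j) with
-- 0 < j < 2^(a+1) are even, so e jumps to m, after 2^(a+1) − (2v+1) 2^u = 2^u (2^r − 2v − 1) steps.

module Submission where

open import Defs
open import Data.Nat using (ℕ; _+_; _*_; _∸_; _^_; _<_; _≤_)
open import Data.Nat using (zero; suc; z≤n; s≤s)
open import Data.Nat.Properties
open import Data.Bool using (Bool; true; false; _xor_; _∧_; if_then_else_)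
open import Data.Bool.Properties
  using ( xor-comm; xor-assoc; xor-same; xor-identityʳ; ∧-distribʳ-xor; ∧-comm
        ; xor-∧-commutativeRing)
open import Data.List using ([]; _∷_; length; drop)
open import Data.List.Properties using (drop-drop)
open import Data.Product using (∃-syntax; _×_; _,_)
open import Function using (_∘_; id)
open import Algebra.Bundles using (AbelianGroup; CommutativeRing)
open import Algebra.Structures using (IsAbelianGroup)
open import Relation.Binary.Bundles using (Setoid)
open import Relation.Binary.Structures using (IsEquivalence)
open import Relation.Binary.PropositionalEquality
open import Relation.Nullary using (¬_)
open import Data.Empty using (⊥-elim)
open import Algebra.Properties.CommutativeSemigroup
  (CommutativeRing.+-commutativeSemigroup xor-∧-commutativeRing)
  using () renaming (interchange to xor-interchange)
import Relation.Binary.Reasoning.Setoid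

coeff : Poly → ℕ → Bool
coeff [] i = false
coeff (a ∷ p) zero = a
coeff (a ∷ p) (suc i) = coeff p i

infix 4 _≈_
record _≈_ (p q : Poly) : Set where
  constructor coeffwise
  field coeff≡ : ∀ i → coeff p i ≡ coeff q i
open _≈_ public

≈-isEquivalence : IsEquivalence _≈_
≈-isEquivalence = record
  { refl = coeffwise λ i → refl
  ; sym = λ h → coeffwise λ i → sym (coeff≡ h i)
  ; trans = λ h g → coeffwise λ i → trans (coeff≡ h i) (coeff≡ g i)
  }

≈-setoid : Setoid _ _
≈-setoid = record { isEquivalence = ≈-isEquivalence }

open Setoid ≈-setoid public
  using () renaming (refl to ≈-refl; reflexive to ≈-reflexive; sym to ≈-sym; trans to ≈-trans)

module ≈-Reasoning = Relation.Binary.Reasoning.Setoid ≈-setoid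

∷-congʳ : ∀ {a p q} → p ≈ q → a ∷ p ≈ a ∷ q
∷-congʳ {a} h = coeffwise λ { zero → refl ; (suc i) → coeff≡ h i }

∷-cong : ∀ {a b p q} → a ≡ b → p ≈ q → a ∷ p ≈ b ∷ q
∷-cong refl h = ∷-congʳ h

false∷[]≈[] : false ∷ [] ≈ []
false∷[]≈[] = coeffwise λ { zero → refl ; (suc i) → refl }

-- A function defined by recursion on the coefficient list respects _≈_ as soon as
-- a trailing zero coefficient does not change its value.
module ConsRecursion {c ℓ} (S : Setoid c ℓ) where

  open Setoid S
    using (Carrier) renaming (_≈_ to _≈ₛ_; refl to ≈ₛ-refl; sym to ≈ₛ-sym; trans to ≈ₛ-trans)

  preserves-≈ : (f : Poly → Carrier) (g : Bool → Carrier → Carrier) →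
    (∀ a {x y} → x ≈ₛ y → g a x ≈ₛ g a y) → (∀ a p → f (a ∷ p) ≈ₛ g a (f p)) →
    g false (f []) ≈ₛ f [] → ∀ {p q} → p ≈ q → f p ≈ₛ f q
  preserves-≈ f g g-cong f-∷ g-false-[] = go
    where
    go : ∀ {p q} → p ≈ q → f p ≈ₛ f q
    go {[]} {[]} h = ≈ₛ-refl
    go {[]} {b ∷ q} h with coeff≡ h 0
    ... | refl = ≈ₛ-trans (≈ₛ-sym g-false-[])
        (≈ₛ-trans (g-cong false (go (coeffwise (coeff≡ h ∘ suc)))) (≈ₛ-sym (f-∷ false q)))
    go {a ∷ p} {[]} h with coeff≡ h 0
    ... | refl = ≈ₛ-trans (f-∷ false p)
        (≈ₛ-trans (g-cong false (go (coeffwise (coeff≡ h ∘ suc)))) g-false-[])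
    go {a ∷ p} {b ∷ q} h with coeff≡ h 0
    ... | refl = ≈ₛ-trans (f-∷ a p)
        (≈ₛ-trans (g-cong a (go (coeffwise (coeff≡ h ∘ suc)))) (≈ₛ-sym (f-∷ a q)))

coeff-⊕ : ∀ p q i → coeff (p ⊕ q) i ≡ coeff p i xor coeff q i
coeff-⊕ [] q i = refl
coeff-⊕ (a ∷ p) [] i = sym (xor-identityʳ _)
coeff-⊕ (a ∷ p) (b ∷ q) zero = refl
coeff-⊕ (a ∷ p) (b ∷ q) (suc i) = coeff-⊕ p q i

⊕-cong : ∀ {p p′ q q′} → p ≈ p′ → q ≈ q′ → p ⊕ q ≈ p′ ⊕ q′
⊕-cong {p} {p′} {q} {q′} h g = coeffwise λ i → begin
  coeff (p ⊕ q) i             ≡⟨ coeff-⊕ p q i ⟩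
  coeff p i xor coeff q i     ≡⟨ cong₂ _xor_ (coeff≡ h i) (coeff≡ g i) ⟩
  coeff p′ i xor coeff q′ i   ≡⟨ coeff-⊕ p′ q′ i ⟨
  coeff (p′ ⊕ q′) i           ∎
  where open ≡-Reasoning

⊕-congˡ : ∀ {p p′} q → p ≈ p′ → p ⊕ q ≈ p′ ⊕ q
⊕-congˡ q h = ⊕-cong h ≈-refl

⊕-congʳ : ∀ p {q q′} → q ≈ q′ → p ⊕ q ≈ p ⊕ q′
⊕-congʳ p h = ⊕-cong ≈-refl h

⊕-comm : ∀ p q → p ⊕ q ≈ q ⊕ p
⊕-comm p q = coeffwise λ i → begin
  coeff (p ⊕ q) i          ≡⟨ coeff-⊕ p q i ⟩
  coeff p i xor coeff q i  ≡⟨ xor-comm (coeff p i) (coeff q i) ⟩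
  coeff q i xor coeff p i  ≡⟨ coeff-⊕ q p i ⟨
  coeff (q ⊕ p) i          ∎
  where open ≡-Reasoning

⊕-assoc : ∀ p q r → (p ⊕ q) ⊕ r ≈ p ⊕ (q ⊕ r)
⊕-assoc p q r = coeffwise λ i → begin
  coeff ((p ⊕ q) ⊕ r) i                        ≡⟨ coeff-⊕ (p ⊕ q) r i ⟩
  coeff (p ⊕ q) i xor coeff r i                ≡⟨ cong (_xor coeff r i) (coeff-⊕ p q i) ⟩
  (coeff p i xor coeff q i) xor coeff r i      ≡⟨ xor-assoc (coeff p i) (coeff q i) (coeff r i) ⟩
  coeff p i xor (coeff q i xor coeff r i)      ≡⟨ cong (coeff p i xor_) (coeff-⊕ q r i) ⟨
  coeff p i xor coeff (q ⊕ r) i                ≡⟨ coeff-⊕ p (q ⊕ r) i ⟨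
  coeff (p ⊕ (q ⊕ r)) i                        ∎
  where open ≡-Reasoning

⊕-identityʳ : ∀ p → p ⊕ [] ≈ p
⊕-identityʳ p = coeffwise λ i → trans (coeff-⊕ p [] i) (xor-identityʳ (coeff p i))

⊕-self : ∀ p → p ⊕ p ≈ []
⊕-self p = coeffwise λ i → trans (coeff-⊕ p p i) (xor-same (coeff p i))

⊕-isAbelianGroup : IsAbelianGroup _≈_ _⊕_ [] id
⊕-isAbelianGroup = record
  { isGroup = record
    { isMonoid = record
      { isSemigroup = record
        { isMagma = record { isEquivalence = ≈-isEquivalence ; ∙-cong = ⊕-cong }
        ; assoc = ⊕-assoc }
      ; identity = (λ p → ≈-refl) , ⊕-identityʳ }
    ; inverse = ⊕-self , ⊕-self
    ; ⁻¹-cong = id }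
  ; comm = ⊕-comm }

⊕-abelianGroup : AbelianGroup _ _
⊕-abelianGroup = record { isAbelianGroup = ⊕-isAbelianGroup }

open import Algebra.Properties.CommutativeSemigroup (AbelianGroup.commutativeSemigroup ⊕-abelianGroup)
  using () renaming (interchange to ⊕-interchange; x∙yz≈y∙xz to ⊕-left-comm)
open import Algebra.Properties.Group (AbelianGroup.group ⊕-abelianGroup)
  using () renaming (\\-leftDividesˡ to ⊕-cancelˡ; x∙y⁻¹≈ε⇒x≈y to ⊕≈[]⇒≈)

scale : Bool → Poly → Poly
scale a q = if a then q else []

scale-cong : ∀ a {q q′} → q ≈ q′ → scale a q ≈ scale a q′
scale-cong false h = ≈-refl
scale-cong true h = h

scale-xor : ∀ a b q → scale (a xor b) q ≈ scale a q ⊕ scale b q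
scale-xor false b q = ≈-refl
scale-xor true false q = ≈-sym (⊕-identityʳ q)
scale-xor true true q = ≈-sym (⊕-self q)

scale-⊕ : ∀ a p q → scale a (p ⊕ q) ≡ scale a p ⊕ scale a q
scale-⊕ false p q = refl
scale-⊕ true p q = refl

scale-∷ : ∀ b a q → scale b (a ∷ q) ≈ (b ∧ a) ∷ scale b q
scale-∷ false a q = ≈-sym false∷[]≈[]
scale-∷ true a q = ≈-refl

scale-⊗ : ∀ a q r → scale a q ⊗ r ≡ scale a (q ⊗ r)
scale-⊗ false q r = refl
scale-⊗ true q r = refl

false∷[]⊕ : ∀ p → (false ∷ []) ⊕ p ≈ p
false∷[]⊕ p = ⊕-congˡ p false∷[]≈[]

∷[]⊗ : ∀ a p → (a ∷ []) ⊗ p ≈ scale a p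
∷[]⊗ a p = ≈-trans (⊕-congʳ (scale a p) false∷[]≈[]) (⊕-identityʳ (scale a p))

⊗-congʳ : ∀ p {q q′} → q ≈ q′ → p ⊗ q ≈ p ⊗ q′
⊗-congʳ [] h = ≈-refl
⊗-congʳ (a ∷ p) h = ⊕-cong (scale-cong a h) (∷-congʳ (⊗-congʳ p h))

⊗-congˡ : ∀ {p p′} q → p ≈ p′ → p ⊗ q ≈ p′ ⊗ q
⊗-congˡ q = ConsRecursion.preserves-≈ ≈-setoid (_⊗ q) (λ a r → scale a q ⊕ (false ∷ r))
  (λ a h → ⊕-congʳ (scale a q) (∷-congʳ h)) (λ a p → ≈-refl) false∷[]≈[]

⊗-cong : ∀ {p p′ q q′} → p ≈ p′ → q ≈ q′ → p ⊗ q ≈ p′ ⊗ q′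
⊗-cong {p′ = p′} {q} h g = ≈-trans (⊗-congˡ q h) (⊗-congʳ p′ g)

⊗-zeroʳ : ∀ p → p ⊗ [] ≈ []
⊗-zeroʳ [] = ≈-refl
⊗-zeroʳ (false ∷ p) = ≈-trans (∷-congʳ (⊗-zeroʳ p)) false∷[]≈[]
⊗-zeroʳ (true ∷ p) = ≈-trans (∷-congʳ (⊗-zeroʳ p)) false∷[]≈[]

⊗-distribʳ : ∀ q p p′ → (p ⊕ p′) ⊗ q ≈ p ⊗ q ⊕ p′ ⊗ q
⊗-distribʳ q [] p′ = ≈-refl
⊗-distribʳ q (a ∷ p) [] = ≈-sym (⊕-identityʳ _)
⊗-distribʳ q (a ∷ p) (b ∷ p′) = begin
  scale (a xor b) q ⊕ (false ∷ (p ⊕ p′) ⊗ q)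
    ≈⟨ ⊕-cong (scale-xor a b q) (∷-congʳ (⊗-distribʳ q p p′)) ⟩
  (scale a q ⊕ scale b q) ⊕ ((false ∷ p ⊗ q) ⊕ (false ∷ p′ ⊗ q))
    ≈⟨ ⊕-interchange (scale a q) (scale b q) (false ∷ p ⊗ q) (false ∷ p′ ⊗ q) ⟩
  (a ∷ p) ⊗ q ⊕ (b ∷ p′) ⊗ q   ∎
  where open ≈-Reasoning

⊗-distribˡ : ∀ q p p′ → q ⊗ (p ⊕ p′) ≈ q ⊗ p ⊕ q ⊗ p′
⊗-distribˡ [] p p′ = ≈-refl
⊗-distribˡ (a ∷ q) p p′ = begin
  scale a (p ⊕ p′) ⊕ (false ∷ q ⊗ (p ⊕ p′))
    ≈⟨ ⊕-cong (≈-reflexive (scale-⊕ a p p′)) (∷-congʳ (⊗-distribˡ q p p′)) ⟩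
  (scale a p ⊕ scale a p′) ⊕ ((false ∷ q ⊗ p) ⊕ (false ∷ q ⊗ p′))
    ≈⟨ ⊕-interchange (scale a p) (scale a p′) (false ∷ q ⊗ p) (false ∷ q ⊗ p′) ⟩
  (a ∷ q) ⊗ p ⊕ (a ∷ q) ⊗ p′   ∎
  where open ≈-Reasoning

⊗-∷ʳ : ∀ p a q → p ⊗ (a ∷ q) ≈ scale a p ⊕ (false ∷ p ⊗ q)
⊗-∷ʳ [] false q = ≈-sym false∷[]≈[]
⊗-∷ʳ [] true q = ≈-sym false∷[]≈[]
⊗-∷ʳ (b ∷ p) a q = begin
  scale b (a ∷ q) ⊕ (false ∷ p ⊗ (a ∷ q))
    ≈⟨ ⊕-cong (scale-∷ b a q) (∷-congʳ (⊗-∷ʳ p a q)) ⟩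
  ((b ∧ a) ∷ scale b q) ⊕ (false ∷ (scale a p ⊕ (false ∷ p ⊗ q)))
    ≈⟨ ∷-cong (cong (_xor false) (∧-comm b a))
              (⊕-left-comm (scale b q) (scale a p) (false ∷ p ⊗ q)) ⟩
  ((a ∧ b) ∷ scale a p) ⊕ (false ∷ (scale b q ⊕ (false ∷ p ⊗ q)))
    ≈⟨ ⊕-congˡ _ (scale-∷ a b p) ⟨
  scale a (b ∷ p) ⊕ (false ∷ (b ∷ p) ⊗ q)   ∎
  where open ≈-Reasoning

⊗-comm : ∀ p q → p ⊗ q ≈ q ⊗ p
⊗-comm [] q = ≈-sym (⊗-zeroʳ q)
⊗-comm (a ∷ p) q =
  ≈-trans (⊕-congʳ (scale a q) (∷-congʳ (⊗-comm p q))) (≈-sym (⊗-∷ʳ q a p))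

⊗-assoc : ∀ p q r → (p ⊗ q) ⊗ r ≈ p ⊗ (q ⊗ r)
⊗-assoc [] q r = ≈-refl
⊗-assoc (a ∷ p) q r = begin
  (scale a q ⊕ (false ∷ p ⊗ q)) ⊗ r
    ≈⟨ ⊗-distribʳ r (scale a q) (false ∷ p ⊗ q) ⟩
  scale a q ⊗ r ⊕ (false ∷ (p ⊗ q) ⊗ r)
    ≈⟨ ⊕-cong (≈-reflexive (scale-⊗ a q r)) (∷-congʳ (⊗-assoc p q r)) ⟩
  scale a (q ⊗ r) ⊕ (false ∷ p ⊗ (q ⊗ r)) ∎
  where open ≈-Reasoning

⊗-identityˡ : ∀ p → one ⊗ p ≈ p
⊗-identityˡ p = ≈-trans (⊕-congʳ p false∷[]≈[]) (⊕-identityʳ p)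

⊗-identityʳ : ∀ p → p ⊗ one ≈ p
⊗-identityʳ p = ≈-trans (⊗-comm p one) (⊗-identityˡ p)

F₂[x] : CommutativeRing _ _
F₂[x] = record
  { Carrier = Poly ; _≈_ = _≈_ ; _+_ = _⊕_ ; _*_ = _⊗_ ; -_ = id ; 0# = [] ; 1# = one
  ; isCommutativeRing = record
    { isRing = record
      { +-isAbelianGroup = ⊕-isAbelianGroup
      ; *-cong = ⊗-cong
      ; *-assoc = ⊗-assoc
      ; *-identity = ⊗-identityˡ , ⊗-identityʳ
      ; distrib = ⊗-distribˡ , ⊗-distribʳ }
    ; *-comm = ⊗-comm }
  }

coeff-⊗-zero : ∀ p q → coeff (p ⊗ q) 0 ≡ coeff p 0 ∧ coeff q 0
coeff-⊗-zero [] q = refl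
coeff-⊗-zero (false ∷ p) q = refl
coeff-⊗-zero (true ∷ p) q = trans (coeff-⊕ q (false ∷ p ⊗ q) 0) (xor-identityʳ (coeff q 0))

open import Algebra.Properties.CommutativeSemiring.Exp (CommutativeRing.commutativeSemiring F₂[x])
  using (^-homo-*; ^-assocʳ; ^-distrib-*) renaming (_^_ to _^ᴿ_)

^ᵖ≡^ᴿ : ∀ p n → p ^ᵖ n ≡ p ^ᴿ n
^ᵖ≡^ᴿ p zero = refl
^ᵖ≡^ᴿ p (suc n) = cong (p ⊗_) (^ᵖ≡^ᴿ p n)

^ᵖ-cong : ∀ {p q} n → p ≈ q → p ^ᵖ n ≈ q ^ᵖ n
^ᵖ-cong zero h = ≈-refl
^ᵖ-cong (suc n) h = ⊗-cong h (^ᵖ-cong n h)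

^ᵖ-+ : ∀ p m n → p ^ᵖ (m + n) ≈ p ^ᵖ m ⊗ p ^ᵖ n
^ᵖ-+ p m n rewrite ^ᵖ≡^ᴿ p (m + n) | ^ᵖ≡^ᴿ p m | ^ᵖ≡^ᴿ p n = ^-homo-* p m n

^ᵖ-* : ∀ p m n → (p ^ᵖ m) ^ᵖ n ≈ p ^ᵖ (m * n)
^ᵖ-* p m n rewrite ^ᵖ≡^ᴿ p m | ^ᵖ≡^ᴿ (p ^ᴿ m) n | ^ᵖ≡^ᴿ p (m * n) = ^-assocʳ p m n

⊗-^ᵖ : ∀ p q n → (p ⊗ q) ^ᵖ n ≈ p ^ᵖ n ⊗ q ^ᵖ n
⊗-^ᵖ p q n rewrite ^ᵖ≡^ᴿ (p ⊗ q) n | ^ᵖ≡^ᴿ p n | ^ᵖ≡^ᴿ q n = ^-distrib-* p q n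

one-^ᵖ : ∀ n → one ^ᵖ n ≈ one
one-^ᵖ zero = ≈-refl
one-^ᵖ (suc n) = ≈-trans (⊗-identityˡ _) (one-^ᵖ n)

⊕-^ᵖ-2 : ∀ p q → (p ⊕ q) ^ᵖ 2 ≈ p ^ᵖ 2 ⊕ q ^ᵖ 2
⊕-^ᵖ-2 p q = begin
  (p ⊕ q) ⊗ ((p ⊕ q) ⊗ one)
    ≈⟨ ⊗-congʳ (p ⊕ q) (⊗-identityʳ (p ⊕ q)) ⟩
  (p ⊕ q) ⊗ (p ⊕ q)
    ≈⟨ ⊗-distribʳ (p ⊕ q) p q ⟩
  p ⊗ (p ⊕ q) ⊕ q ⊗ (p ⊕ q)
    ≈⟨ ⊕-cong (⊗-distribˡ p p q) (⊗-distribˡ q p q) ⟩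
  (p ⊗ p ⊕ p ⊗ q) ⊕ (q ⊗ p ⊕ q ⊗ q)
    ≈⟨ ⊕-congʳ (p ⊗ p ⊕ p ⊗ q) (⊕-congˡ (q ⊗ q) (⊗-comm q p)) ⟩
  (p ⊗ p ⊕ p ⊗ q) ⊕ (p ⊗ q ⊕ q ⊗ q)
    ≈⟨ ⊕-assoc (p ⊗ p) (p ⊗ q) (p ⊗ q ⊕ q ⊗ q) ⟩
  p ⊗ p ⊕ (p ⊗ q ⊕ (p ⊗ q ⊕ q ⊗ q))
    ≈⟨ ⊕-congʳ (p ⊗ p) (⊕-cancelˡ (p ⊗ q) (q ⊗ q)) ⟩
  p ⊗ p ⊕ q ⊗ q
    ≈⟨ ⊕-cong (⊗-congʳ p (⊗-identityʳ p)) (⊗-congʳ q (⊗-identityʳ q)) ⟨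
  p ^ᵖ 2 ⊕ q ^ᵖ 2 ∎
  where open ≈-Reasoning

⊕-^ᵖ-2^ : ∀ u p q → (p ⊕ q) ^ᵖ (2 ^ u) ≈ p ^ᵖ (2 ^ u) ⊕ q ^ᵖ (2 ^ u)
⊕-^ᵖ-2^ zero p q =
  ≈-trans (⊗-identityʳ (p ⊕ q)) (≈-sym (⊕-cong (⊗-identityʳ p) (⊗-identityʳ q)))
⊕-^ᵖ-2^ (suc u) p q = begin
  (p ⊕ q) ^ᵖ (2 * 2 ^ u)                     ≈⟨ ^ᵖ-* (p ⊕ q) 2 (2 ^ u) ⟨
  ((p ⊕ q) ^ᵖ 2) ^ᵖ (2 ^ u)                  ≈⟨ ^ᵖ-cong (2 ^ u) (⊕-^ᵖ-2 p q) ⟩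
  (p ^ᵖ 2 ⊕ q ^ᵖ 2) ^ᵖ (2 ^ u)               ≈⟨ ⊕-^ᵖ-2^ u (p ^ᵖ 2) (q ^ᵖ 2) ⟩
  (p ^ᵖ 2) ^ᵖ (2 ^ u) ⊕ (q ^ᵖ 2) ^ᵖ (2 ^ u)  ≈⟨ ⊕-cong (^ᵖ-* p 2 (2 ^ u)) (^ᵖ-* q 2 (2 ^ u)) ⟩
  p ^ᵖ (2 * 2 ^ u) ⊕ q ^ᵖ (2 * 2 ^ u)        ∎
  where open ≈-Reasoning

coeff-^ᵖ-zero : ∀ p n → coeff p 0 ≡ true → coeff (p ^ᵖ n) 0 ≡ true
coeff-^ᵖ-zero p zero _ = refl
coeff-^ᵖ-zero p (suc n) p₀ =
  trans (coeff-⊗-zero p (p ^ᵖ n)) (cong₂ _∧_ p₀ (coeff-^ᵖ-zero p n p₀))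

geomSum-cong : ∀ {p q} n → p ≈ q → geomSum p n ≈ geomSum q n
geomSum-cong zero h = ≈-refl
geomSum-cong (suc n) h = ⊕-cong (^ᵖ-cong (suc n) h) (geomSum-cong n h)

geomSum-telescope : ∀ p n → (p ⊕ one) ⊗ geomSum p n ≈ p ^ᵖ suc n ⊕ one
geomSum-telescope p zero =
  ≈-trans (⊗-identityʳ (p ⊕ one)) (⊕-congˡ one (≈-sym (⊗-identityʳ p)))
geomSum-telescope p (suc n) = begin
  (p ⊕ one) ⊗ (P ⊕ geomSum p n)
    ≈⟨ ⊗-distribˡ (p ⊕ one) P (geomSum p n) ⟩
  (p ⊕ one) ⊗ P ⊕ (p ⊕ one) ⊗ geomSum p n
    ≈⟨ ⊕-cong (⊗-distribʳ P p one) (geomSum-telescope p n) ⟩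
  (p ⊗ P ⊕ one ⊗ P) ⊕ (P ⊕ one)
    ≈⟨ ⊕-congˡ (P ⊕ one) (⊕-congʳ (p ⊗ P) (⊗-identityˡ P)) ⟩
  (p ⊗ P ⊕ P) ⊕ (P ⊕ one)
    ≈⟨ ⊕-assoc (p ⊗ P) P (P ⊕ one) ⟩
  p ⊗ P ⊕ (P ⊕ (P ⊕ one))
    ≈⟨ ⊕-congʳ (p ⊗ P) (⊕-cancelˡ P one) ⟩
  p ⊗ P ⊕ one ∎
  where
  open ≈-Reasoning
  P = p ^ᵖ suc n

coeff-geomSum-even : ∀ {p} v → coeff p 0 ≡ true → coeff (geomSum p (2 * v)) 0 ≡ true
coeff-geomSum-even zero _ = refl
coeff-geomSum-even {p} (suc v) p₀ = begin
  coeff (geomSum p (2 * suc v)) 0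
    ≡⟨ cong (λ m → coeff (geomSum p m) 0) (*-suc 2 v) ⟩
  coeff (p ^ᵖ (2 + n) ⊕ (p ^ᵖ (1 + n) ⊕ geomSum p n)) 0
    ≡⟨ coeff-⊕ (p ^ᵖ (2 + n)) (p ^ᵖ (1 + n) ⊕ geomSum p n) 0 ⟩
  coeff (p ^ᵖ (2 + n)) 0 xor coeff (p ^ᵖ (1 + n) ⊕ geomSum p n) 0
    ≡⟨ cong₂ _xor_ (coeff-^ᵖ-zero p (2 + n) p₀) (coeff-⊕ (p ^ᵖ (1 + n)) (geomSum p n) 0) ⟩
  true xor (coeff (p ^ᵖ (1 + n)) 0 xor coeff (geomSum p n) 0)
    ≡⟨ cong (λ c → true xor (c xor coeff (geomSum p n) 0)) (coeff-^ᵖ-zero p (1 + n) p₀) ⟩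
  true xor (true xor coeff (geomSum p n) 0)
    ≡⟨ xor-assoc true true (coeff (geomSum p n) 0) ⟨
  coeff (geomSum p n) 0
    ≡⟨ coeff-geomSum-even v p₀ ⟩
  true ∎
  where
  open ≡-Reasoning
  n = 2 * v

X X+1 : Poly
X = false ∷ true ∷ []
X+1 = true ∷ true ∷ []

X⊗ : ∀ p → X ⊗ p ≈ false ∷ p
X⊗ p = ∷-congʳ (⊗-identityˡ p)

X+1⊗ : ∀ p → X+1 ⊗ p ≈ p ⊕ (false ∷ p)
X+1⊗ p = ⊕-congʳ p (X⊗ p)

X^suc⊗ : ∀ k p → X ^ᵖ suc k ⊗ p ≈ false ∷ (X ^ᵖ k ⊗ p)
X^suc⊗ k p = ≈-trans (⊗-assoc X (X ^ᵖ k) p) (X⊗ (X ^ᵖ k ⊗ p))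

coeff-X^k⊗-< : ∀ k p j → j < k → coeff (X ^ᵖ k ⊗ p) j ≡ false
coeff-X^k⊗-< (suc k) p zero _ = coeff≡ (X^suc⊗ k p) zero
coeff-X^k⊗-< (suc k) p (suc j) (s≤s j<k) =
  trans (coeff≡ (X^suc⊗ k p) (suc j)) (coeff-X^k⊗-< k p j j<k)

coeff-X^k⊗-+ : ∀ k p i → coeff (X ^ᵖ k ⊗ p) (k + i) ≡ coeff p i
coeff-X^k⊗-+ zero p i = coeff≡ (⊗-identityˡ p) i
coeff-X^k⊗-+ (suc k) p i = trans (coeff≡ (X^suc⊗ k p) (suc (k + i))) (coeff-X^k⊗-+ k p i)

coeff-drop : ∀ k p i → coeff (drop k p) i ≡ coeff p (k + i)
coeff-drop zero p i = refl
coeff-drop (suc k) [] i = refl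
coeff-drop (suc k) (a ∷ p) i = coeff-drop k p i

≈X^k⊗drop : ∀ k p → (∀ j → j < k → coeff p j ≡ false) → p ≈ X ^ᵖ k ⊗ drop k p
≈X^k⊗drop zero p _ = ≈-sym (⊗-identityˡ p)
≈X^k⊗drop (suc k) [] _ = ≈-sym (⊗-zeroʳ (X ^ᵖ suc k))
≈X^k⊗drop (suc k) (a ∷ p) below-k = begin
  a ∷ p
    ≈⟨ ∷-cong (below-k 0 (s≤s z≤n)) (≈X^k⊗drop k p (λ j j<k → below-k (suc j) (s≤s j<k))) ⟩
  false ∷ (X ^ᵖ k ⊗ drop k p)
    ≈⟨ X^suc⊗ k (drop k p) ⟨
  X ^ᵖ suc k ⊗ drop (suc k) (a ∷ p) ∎
  where open ≈-Reasoning

drop-cong : ∀ k {p q} → p ≈ q → drop k p ≈ drop k q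
drop-cong k {p} {q} h = coeffwise λ i →
  trans (coeff-drop k p i) (trans (coeff≡ h (k + i)) (sym (coeff-drop k q i)))

drop-X^k⊗ : ∀ k p → drop k (X ^ᵖ k ⊗ p) ≈ p
drop-X^k⊗ k p = coeffwise λ i → trans (coeff-drop k (X ^ᵖ k ⊗ p) i) (coeff-X^k⊗-+ k p i)

drop-⊕-one : ∀ {k} p → 0 < k → drop k (p ⊕ one) ≈ drop k p
drop-⊕-one {suc k} p _ = coeffwise λ i → begin
  coeff (drop (suc k) (p ⊕ one)) i         ≡⟨ coeff-drop (suc k) (p ⊕ one) i ⟩
  coeff (p ⊕ one) (suc (k + i))            ≡⟨ coeff-⊕ p one (suc (k + i)) ⟩
  coeff p (suc (k + i)) xor false          ≡⟨ xor-identityʳ _ ⟩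
  coeff p (suc (k + i))                    ≡⟨ coeff-drop (suc k) p i ⟨
  coeff (drop (suc k) p) i                 ∎
  where open ≡-Reasoning

coeff-X+1⊗-zero : ∀ p → coeff (X+1 ⊗ p) 0 ≡ coeff p 0
coeff-X+1⊗-zero p = trans (coeff≡ (X+1⊗ p) 0) (trans (coeff-⊕ p (false ∷ p) 0) (xor-identityʳ _))

coeff-X+1⊗-suc : ∀ p i → coeff (X+1 ⊗ p) (suc i) ≡ coeff p (suc i) xor coeff p i
coeff-X+1⊗-suc p i = trans (coeff≡ (X+1⊗ p) (suc i)) (coeff-⊕ p (false ∷ p) (suc i))

X+1⊗-≈[] : ∀ p → X+1 ⊗ p ≈ [] → p ≈ []
X+1⊗-≈[] p h = coeffwise vanishes
  where
  vanishes : ∀ i → coeff p i ≡ false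
  vanishes zero = trans (sym (coeff-X+1⊗-zero p)) (coeff≡ h 0)
  vanishes (suc i) = begin
    coeff p (suc i)                       ≡⟨ xor-identityʳ (coeff p (suc i)) ⟨
    coeff p (suc i) xor false             ≡⟨ cong (coeff p (suc i) xor_) (vanishes i) ⟨
    coeff p (suc i) xor coeff p i         ≡⟨ coeff-X+1⊗-suc p i ⟨
    coeff (X+1 ⊗ p) (suc i)               ≡⟨ coeff≡ h (suc i) ⟩
    false                                 ∎
    where open ≡-Reasoning

X+1⊗-cancel : ∀ {p q} → X+1 ⊗ p ≈ X+1 ⊗ q → p ≈ q
X+1⊗-cancel {p} {q} h = ⊕≈[]⇒≈ p q (X+1⊗-≈[] (p ⊕ q) (begin
  X+1 ⊗ (p ⊕ q)           ≈⟨ ⊗-distribˡ X+1 p q ⟩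
  X+1 ⊗ p ⊕ X+1 ⊗ q       ≈⟨ ⊕-congˡ (X+1 ⊗ q) h ⟩
  X+1 ⊗ q ⊕ X+1 ⊗ q       ≈⟨ ⊕-self (X+1 ⊗ q) ⟩
  []                      ∎))
  where open ≈-Reasoning

eval1-⊕ : ∀ p q → eval1 (p ⊕ q) ≡ eval1 p xor eval1 q
eval1-⊕ [] q = refl
eval1-⊕ (a ∷ p) [] = sym (xor-identityʳ _)
eval1-⊕ (a ∷ p) (b ∷ q) = begin
  (a xor b) xor eval1 (p ⊕ q)             ≡⟨ cong ((a xor b) xor_) (eval1-⊕ p q) ⟩
  (a xor b) xor (eval1 p xor eval1 q)     ≡⟨ xor-interchange a b (eval1 p) (eval1 q) ⟩
  (a xor eval1 p) xor (b xor eval1 q)     ∎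
  where open ≡-Reasoning

eval1-scale : ∀ a q → eval1 (scale a q) ≡ a ∧ eval1 q
eval1-scale false q = refl
eval1-scale true q = refl

eval1-⊗ : ∀ p q → eval1 (p ⊗ q) ≡ eval1 p ∧ eval1 q
eval1-⊗ [] q = refl
eval1-⊗ (a ∷ p) q = begin
  eval1 (scale a q ⊕ (false ∷ p ⊗ q))           ≡⟨ eval1-⊕ (scale a q) (false ∷ p ⊗ q) ⟩
  eval1 (scale a q) xor eval1 (p ⊗ q)           ≡⟨ cong₂ _xor_ (eval1-scale a q) (eval1-⊗ p q) ⟩
  (a ∧ eval1 q) xor (eval1 p ∧ eval1 q)         ≡⟨ ∧-distribʳ-xor (eval1 q) a (eval1 p) ⟨
  (a xor eval1 p) ∧ eval1 q                     ∎
  where open ≡-Reasoning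

eval1-cong : ∀ {p q} → p ≈ q → eval1 p ≡ eval1 q
eval1-cong =
  ConsRecursion.preserves-≈ (setoid Bool) eval1 _xor_ (λ a → cong (a xor_)) (λ a p → refl) refl

-- Binomial coefficients mod 2

binom : ℕ → ℕ → Bool
binom m j = coeff (X+1 ^ᵖ m) j

binom-zero : ∀ m → binom m 0 ≡ true
binom-zero zero = refl
binom-zero (suc m) = trans (coeff-X+1⊗-zero (X+1 ^ᵖ m)) (binom-zero m)

binom-pascal : ∀ m j → binom (suc m) (suc j) ≡ binom m (suc j) xor binom m j
binom-pascal m j = coeff-X+1⊗-suc (X+1 ^ᵖ m) j

binom-high : ∀ m j → m < j → binom m j ≡ false
binom-high zero (suc j) _ = refl
binom-high (suc m) (suc j) (s≤s m<j) = trans (binom-pascal m j)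
  (cong₂ _xor_ (binom-high m (suc j) (m<n⇒m<1+n m<j)) (binom-high m j m<j))

binom-diag : ∀ m → binom m m ≡ true
binom-diag zero = refl
binom-diag (suc m) =
  trans (binom-pascal m m) (cong₂ _xor_ (binom-high m (suc m) (n<1+n m)) (binom-diag m))

X+1^2^ : ∀ a → X+1 ^ᵖ (2 ^ a) ≈ one ⊕ X ^ᵖ (2 ^ a)
X+1^2^ a = ≈-trans (⊕-^ᵖ-2^ a one X) (⊕-congˡ (X ^ᵖ (2 ^ a)) (one-^ᵖ (2 ^ a)))

binom-2^ : ∀ a j → 0 < j → j < 2 ^ a → binom (2 ^ a) j ≡ false
binom-2^ a (suc j) _ j<2^a = begin
  binom (2 ^ a) (suc j)                     ≡⟨ coeff≡ (X+1^2^ a) (suc j) ⟩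
  coeff (one ⊕ X ^ᵖ (2 ^ a)) (suc j)        ≡⟨ coeff-⊕ one (X ^ᵖ (2 ^ a)) (suc j) ⟩
  coeff (X ^ᵖ (2 ^ a)) (suc j)              ≡⟨ coeff≡ (⊗-identityʳ (X ^ᵖ (2 ^ a))) (suc j) ⟨
  coeff (X ^ᵖ (2 ^ a) ⊗ one) (suc j)        ≡⟨ coeff-X^k⊗-< (2 ^ a) one (suc j) j<2^a ⟩
  false                                     ∎
  where open ≡-Reasoning

-- Lucas' theorem in the special case (1 + t)^(2^a + r) = (1 + t^(2^a)) (1 + t)^r with r < 2^a.
binom-2^+ : ∀ a r → r < 2 ^ a → binom (2 ^ a + r) r ≡ true
binom-2^+ a r r<2^a = begin
  binom (2 ^ a + r) r
    ≡⟨ coeff≡ (^ᵖ-+ X+1 (2 ^ a) r) r ⟩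
  coeff (X+1 ^ᵖ (2 ^ a) ⊗ P) r
    ≡⟨ coeff≡ (⊗-congˡ P (X+1^2^ a)) r ⟩
  coeff ((one ⊕ X ^ᵖ (2 ^ a)) ⊗ P) r
    ≡⟨ coeff≡ (⊗-distribʳ P one (X ^ᵖ (2 ^ a))) r ⟩
  coeff (one ⊗ P ⊕ X ^ᵖ (2 ^ a) ⊗ P) r
    ≡⟨ coeff-⊕ (one ⊗ P) (X ^ᵖ (2 ^ a) ⊗ P) r ⟩
  coeff (one ⊗ P) r xor coeff (X ^ᵖ (2 ^ a) ⊗ P) r
    ≡⟨ cong₂ _xor_ (trans (coeff≡ (⊗-identityˡ P) r) (binom-diag r))
                   (coeff-X^k⊗-< (2 ^ a) P r r<2^a) ⟩
  true ∎
  where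
  open ≡-Reasoning
  P = X+1 ^ᵖ r

-- The substitution t ↦ x² + x

-- φ p = p(x² + x), the ring map F₂[t] → F₂[x] with t ↦ x(x + 1); it sends 1 + t to M.
φ : Poly → Poly
φ [] = []
φ (c ∷ b) = (c ∷ []) ⊕ (X ⊗ X+1) ⊗ φ b

φ-cong : ∀ {p q} → p ≈ q → φ p ≈ φ q
φ-cong = ConsRecursion.preserves-≈ ≈-setoid φ (λ c r → (c ∷ []) ⊕ (X ⊗ X+1) ⊗ r)
  (λ c h → ⊕-congʳ (c ∷ []) (⊗-congʳ (X ⊗ X+1) h)) (λ c b → ≈-refl)
  (≈-trans (⊕-congʳ (false ∷ []) (⊗-zeroʳ (X ⊗ X+1))) false∷[]≈[])

φ-⊕ : ∀ p q → φ (p ⊕ q) ≈ φ p ⊕ φ q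
φ-⊕ [] q = ≈-refl
φ-⊕ (a ∷ p) [] = ≈-sym (⊕-identityʳ _)
φ-⊕ (a ∷ p) (b ∷ q) = begin
  ((a ∷ []) ⊕ (b ∷ [])) ⊕ Y ⊗ φ (p ⊕ q)
    ≈⟨ ⊕-congʳ ((a ∷ []) ⊕ (b ∷ [])) (⊗-congʳ Y (φ-⊕ p q)) ⟩
  ((a ∷ []) ⊕ (b ∷ [])) ⊕ Y ⊗ (φ p ⊕ φ q)
    ≈⟨ ⊕-congʳ ((a ∷ []) ⊕ (b ∷ [])) (⊗-distribˡ Y (φ p) (φ q)) ⟩
  ((a ∷ []) ⊕ (b ∷ [])) ⊕ (Y ⊗ φ p ⊕ Y ⊗ φ q)
    ≈⟨ ⊕-interchange (a ∷ []) (b ∷ []) (Y ⊗ φ p) (Y ⊗ φ q) ⟩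
  φ (a ∷ p) ⊕ φ (b ∷ q) ∎
  where
  open ≈-Reasoning
  Y = X ⊗ X+1

φ-scale : ∀ a p → φ (scale a p) ≡ scale a (φ p)
φ-scale false p = refl
φ-scale true p = refl

φ-⊗ : ∀ p q → φ (p ⊗ q) ≈ φ p ⊗ φ q
φ-⊗ [] q = ≈-refl
φ-⊗ (a ∷ p) q = begin
  φ (scale a q ⊕ (false ∷ p ⊗ q))
    ≈⟨ φ-⊕ (scale a q) (false ∷ p ⊗ q) ⟩
  φ (scale a q) ⊕ ((false ∷ []) ⊕ Y ⊗ φ (p ⊗ q))
    ≈⟨ ⊕-cong (≈-reflexive (φ-scale a q)) (false∷[]⊕ _) ⟩
  scale a (φ q) ⊕ Y ⊗ φ (p ⊗ q)
    ≈⟨ ⊕-cong (∷[]⊗ a (φ q)) (⊗-congʳ Y (≈-sym (φ-⊗ p q))) ⟨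
  (a ∷ []) ⊗ φ q ⊕ Y ⊗ (φ p ⊗ φ q)
    ≈⟨ ⊕-congʳ _ (⊗-assoc Y (φ p) (φ q)) ⟨
  (a ∷ []) ⊗ φ q ⊕ (Y ⊗ φ p) ⊗ φ q
    ≈⟨ ⊗-distribʳ (φ q) (a ∷ []) (Y ⊗ φ p) ⟨
  φ (a ∷ p) ⊗ φ q ∎
  where
  open ≈-Reasoning
  Y = X ⊗ X+1

φ-one : φ one ≈ one
φ-one = ≈-trans (⊕-congʳ one (⊗-zeroʳ (X ⊗ X+1))) (⊕-identityʳ one)

φ-X : φ X ≈ X ⊗ X+1
φ-X = ≈-trans (⊗-congʳ (X ⊗ X+1) φ-one) (⊗-identityʳ (X ⊗ X+1))

φ-X+1 : φ X+1 ≈ M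
φ-X+1 = ⊕-congʳ one φ-X

φ-^ᵖ : ∀ p n → φ (p ^ᵖ n) ≈ φ p ^ᵖ n
φ-^ᵖ p zero = φ-one
φ-^ᵖ p (suc n) = ≈-trans (φ-⊗ p (p ^ᵖ n)) (⊗-congʳ (φ p) (φ-^ᵖ p n))

φ-geomSum : ∀ p n → φ (geomSum p n) ≈ geomSum (φ p) n
φ-geomSum p zero = φ-one
φ-geomSum p (suc n) =
  ≈-trans (φ-⊕ (p ^ᵖ suc n) (geomSum p n)) (⊕-cong (φ-^ᵖ p (suc n)) (φ-geomSum p n))

φ-X^k⊗ : ∀ k b → φ (X ^ᵖ k ⊗ b) ≈ X ^ᵖ k ⊗ (X+1 ^ᵖ k ⊗ φ b)
φ-X^k⊗ k b = begin
  φ (X ^ᵖ k ⊗ b)                    ≈⟨ φ-⊗ (X ^ᵖ k) b ⟩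
  φ (X ^ᵖ k) ⊗ φ b                  ≈⟨ ⊗-congˡ (φ b) (≈-trans (φ-^ᵖ X k) (^ᵖ-cong k φ-X)) ⟩
  (X ⊗ X+1) ^ᵖ k ⊗ φ b              ≈⟨ ⊗-congˡ (φ b) (⊗-^ᵖ X X+1 k) ⟩
  (X ^ᵖ k ⊗ X+1 ^ᵖ k) ⊗ φ b         ≈⟨ ⊗-assoc (X ^ᵖ k) (X+1 ^ᵖ k) (φ b) ⟩
  X ^ᵖ k ⊗ (X+1 ^ᵖ k ⊗ φ b)         ∎
  where open ≈-Reasoning

coeff-φ-zero : ∀ b → coeff (φ b) 0 ≡ coeff b 0
coeff-φ-zero [] = refl
coeff-φ-zero (c ∷ b) = xor-identityʳ c

-- φ b evaluated at x = 1 is b evaluated at t = 1² + 1 = 0.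
eval1-φ : ∀ b → eval1 (φ b) ≡ coeff b 0
eval1-φ [] = refl
eval1-φ (c ∷ b) = begin
  eval1 ((c ∷ []) ⊕ (X ⊗ X+1) ⊗ φ b)
    ≡⟨ eval1-⊕ (c ∷ []) ((X ⊗ X+1) ⊗ φ b) ⟩
  (c xor false) xor eval1 ((X ⊗ X+1) ⊗ φ b)
    ≡⟨ cong ((c xor false) xor_) (eval1-⊗ (X ⊗ X+1) (φ b)) ⟩
  (c xor false) xor false
    ≡⟨ trans (xor-identityʳ _) (xor-identityʳ c) ⟩
  c ∎
  where open ≡-Reasoning

φ-≈[] : ∀ b → φ b ≈ [] → b ≈ []
φ-≈[] [] h = h
φ-≈[] (c ∷ b) h =
  ≈-trans (∷-cong c≡false (φ-≈[] b (X+1⊗-≈[] (φ b) tail≈[]))) false∷[]≈[]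
  where
  c≡false : c ≡ false
  c≡false = trans (sym (xor-identityʳ c)) (coeff≡ h 0)
  tail≈[] : X+1 ⊗ φ b ≈ []
  tail≈[] = coeffwise λ i → begin
    coeff (X+1 ⊗ φ b) i
      ≡⟨ coeff≡ (≈-trans (⊗-assoc X X+1 (φ b)) (X⊗ (X+1 ⊗ φ b))) (suc i) ⟨
    coeff ((X ⊗ X+1) ⊗ φ b) (suc i)
      ≡⟨ coeff-⊕ (c ∷ []) ((X ⊗ X+1) ⊗ φ b) (suc i) ⟨
    coeff ((c ∷ []) ⊕ (X ⊗ X+1) ⊗ φ b) (suc i)
      ≡⟨ coeff≡ h (suc i) ⟩
    false ∎
    where open ≡-Reasoning

φ-injective : ∀ {p q} → φ p ≈ φ q → p ≈ q
φ-injective {p} {q} h = ⊕≈[]⇒≈ p q (φ-≈[] (p ⊕ q) (begin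
  φ (p ⊕ q)   ≈⟨ φ-⊕ p q ⟩
  φ p ⊕ φ q   ≈⟨ ⊕-congˡ (φ q) h ⟩
  φ q ⊕ φ q   ≈⟨ ⊕-self (φ q) ⟩
  []          ∎))
  where open ≈-Reasoning

-- Odd parts

ncons : Bool → Poly → Poly
ncons a [] = if a then true ∷ [] else []
ncons a q@(_ ∷ _) = a ∷ q

normalize-∷ : ∀ a p → normalize (a ∷ p) ≡ ncons a (normalize p)
normalize-∷ a p with normalize p
... | [] = refl
... | _ ∷ _ = refl

ncons≈∷ : ∀ a r → ncons a r ≈ a ∷ r
ncons≈∷ false [] = ≈-sym false∷[]≈[]
ncons≈∷ true [] = ≈-refl
ncons≈∷ a (_ ∷ _) = ≈-refl

normalize≈ : ∀ p → normalize p ≈ p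
normalize≈ [] = ≈-refl
normalize≈ (a ∷ p) = ≈-trans (≈-reflexive (normalize-∷ a p))
  (≈-trans (ncons≈∷ a (normalize p)) (∷-congʳ (normalize≈ p)))

normalize-cong : ∀ {p q} → p ≈ q → normalize p ≡ normalize q
normalize-cong =
  ConsRecursion.preserves-≈ (setoid Poly) normalize ncons (λ a → cong (ncons a)) normalize-∷ refl

IsOne⇒≈one : ∀ {p} → IsOne p → p ≈ one
IsOne⇒≈one {p} p-one = ≈-trans (≈-sym (normalize≈ p)) (≈-reflexive p-one)

≈one⇒IsOne : ∀ {p} → p ≈ one → IsOne p
≈one⇒IsOne = normalize-cong

stripX-X^k⊗ : ∀ k q s → q ≈ X ^ᵖ k ⊗ s → coeff s 0 ≡ true → stripX q ≈ s
stripX-X^k⊗ zero [] s h s₀ with trans (coeff≡ (≈-trans h (⊗-identityˡ s)) 0) s₀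
... | ()
stripX-X^k⊗ zero (false ∷ q) s h s₀ with trans (coeff≡ (≈-trans h (⊗-identityˡ s)) 0) s₀
... | ()
stripX-X^k⊗ zero (true ∷ q) s h s₀ = ≈-trans h (⊗-identityˡ s)
stripX-X^k⊗ (suc k) [] s h s₀
  with trans (trans (coeff≡ h (suc k + 0)) (coeff-X^k⊗-+ (suc k) s 0)) s₀
... | ()
stripX-X^k⊗ (suc k) (true ∷ q) s h s₀
  with trans (coeff≡ h 0) (coeff-X^k⊗-< (suc k) s 0 (s≤s z≤n))
... | ()
stripX-X^k⊗ (suc k) (false ∷ q) s h s₀ =
  stripX-X^k⊗ k q s (coeffwise λ i → coeff≡ (≈-trans h (X^suc⊗ k s)) (suc i)) s₀

divX1-aux-correct : ∀ s p → s xor eval1 p ≡ false → X+1 ⊗ divX1-aux s p ≈ (s ∷ []) ⊕ p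
divX1-aux-correct s [] e = ≈-trans (⊗-zeroʳ X+1)
  (≈-sym (≈-trans (∷-cong (trans (sym (xor-identityʳ s)) e) ≈-refl) false∷[]≈[]))
divX1-aux-correct s (a ∷ []) e = ≈-trans (⊗-zeroʳ X+1)
  (≈-sym (≈-trans (∷-cong (trans (cong (s xor_) (sym (xor-identityʳ a))) e) ≈-refl) false∷[]≈[]))
divX1-aux-correct s (a ∷ b ∷ p) e = begin
  X+1 ⊗ (c ∷ w)
    ≈⟨ X+1⊗ (c ∷ w) ⟩
  (c ∷ w) ⊕ (false ∷ c ∷ w)
    ≈⟨ ∷-cong (xor-identityʳ c) (⊕-congʳ w (∷≈ c w)) ⟩
  c ∷ (w ⊕ ((c ∷ []) ⊕ (false ∷ w)))
    ≈⟨ ∷-congʳ (⊕-left-comm w (c ∷ []) (false ∷ w)) ⟩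
  c ∷ ((c ∷ []) ⊕ (w ⊕ (false ∷ w)))
    ≈⟨ ∷-congʳ (⊕-congʳ (c ∷ []) (X+1⊗ w)) ⟨
  c ∷ ((c ∷ []) ⊕ X+1 ⊗ w)
    ≈⟨ ∷-congʳ (⊕-congʳ (c ∷ []) (divX1-aux-correct c (b ∷ p) e′)) ⟩
  c ∷ ((c ∷ []) ⊕ ((c ∷ []) ⊕ (b ∷ p)))
    ≈⟨ ∷-congʳ (⊕-cancelˡ (c ∷ []) (b ∷ p)) ⟩
  c ∷ b ∷ p ∎
  where
  open ≈-Reasoning
  c = s xor a
  w = divX1-aux c (b ∷ p)
  e′ : c xor eval1 (b ∷ p) ≡ false
  e′ = trans (xor-assoc s a (eval1 (b ∷ p))) e
  ∷≈ : ∀ c w → c ∷ w ≈ (c ∷ []) ⊕ (false ∷ w)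
  ∷≈ c w = ∷-cong (sym (xor-identityʳ c)) ≈-refl

divX1-correct : ∀ p → eval1 p ≡ false → X+1 ⊗ divX1 p ≈ p
divX1-correct p p[1]≡0 = ≈-trans (divX1-aux-correct false p p[1]≡0) (false∷[]⊕ p)

length-divX1-aux : ∀ s a p → length (divX1-aux s (a ∷ p)) ≡ length p
length-divX1-aux s a [] = refl
length-divX1-aux s a (b ∷ p) = cong suc (length-divX1-aux (s xor a) b p)

length-normalize : ∀ p → length (normalize p) ≤ length p
length-normalize [] = z≤n
length-normalize (a ∷ p) rewrite normalize-∷ a p =
  ≤-trans (length-ncons a (normalize p)) (s≤s (length-normalize p))
  where
  length-ncons : ∀ a r → length (ncons a r) ≤ suc (length r)
  length-ncons false [] = z≤n
  length-ncons true [] = ≤-refl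
  length-ncons a (_ ∷ _) = ≤-refl

eval1-X+1^suc⊗ : ∀ k r → eval1 (X+1 ^ᵖ suc k ⊗ r) ≡ false
eval1-X+1^suc⊗ k r =
  trans (eval1-⊗ (X+1 ^ᵖ suc k) r) (cong (_∧ eval1 r) (eval1-⊗ X+1 (X+1 ^ᵖ k)))

stripX1-X+1^k⊗ : ∀ k fuel q r → q ≈ X+1 ^ᵖ k ⊗ r → coeff r 0 ≡ true → eval1 r ≡ true →
  length q ≤ fuel → stripX1-fuel fuel q ≈ r
stripX1-X+1^k⊗ k fuel [] r h r₀ r₁ _
  with trans (coeff≡ h 0) (trans (coeff-⊗-zero (X+1 ^ᵖ k) r) (cong₂ _∧_ (binom-zero k) r₀))
... | ()
stripX1-X+1^k⊗ k (suc fuel) (a ∷ q) r h r₀ r₁ (s≤s len≤fuel) with eval1 (a ∷ q) in q[1]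
stripX1-X+1^k⊗ zero (suc fuel) (a ∷ q) r h r₀ r₁ _ | true = ≈-trans h (⊗-identityˡ r)
stripX1-X+1^k⊗ (suc k) (suc fuel) (a ∷ q) r h r₀ r₁ _ | true
  with trans (sym q[1]) (trans (eval1-cong h) (eval1-X+1^suc⊗ k r))
... | ()
stripX1-X+1^k⊗ zero (suc fuel) (a ∷ q) r h r₀ r₁ _ | false
  with trans (sym q[1]) (trans (eval1-cong (≈-trans h (⊗-identityˡ r))) r₁)
... | ()
stripX1-X+1^k⊗ (suc k) (suc fuel) (a ∷ q) r h r₀ r₁ (s≤s len≤fuel) | false =
  stripX1-X+1^k⊗ k fuel (normalize (divX1 (a ∷ q))) r quotient r₀ r₁
    (≤-trans (length-normalize (divX1 (a ∷ q)))
             (≤-trans (≤-reflexive (length-divX1-aux false a q)) len≤fuel))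
  where
  quotient : normalize (divX1 (a ∷ q)) ≈ X+1 ^ᵖ k ⊗ r
  quotient = ≈-trans (normalize≈ _) (X+1⊗-cancel (≈-trans (divX1-correct (a ∷ q) q[1])
    (≈-trans h (⊗-assoc X+1 (X+1 ^ᵖ k) r))))

oddPart-X^a⊗X+1^b⊗ : ∀ a b p r → p ≈ X ^ᵖ a ⊗ (X+1 ^ᵖ b ⊗ r) →
  coeff r 0 ≡ true → eval1 r ≡ true → oddPart p ≈ r
oddPart-X^a⊗X+1^b⊗ a b p r h r₀ r₁ = stripX1-X+1^k⊗ b (length q) q r
  (stripX-X^k⊗ a (normalize p) (X+1 ^ᵖ b ⊗ r) (≈-trans (normalize≈ p) h)
    (trans (coeff-⊗-zero (X+1 ^ᵖ b) r) (cong₂ _∧_ (binom-zero b) r₀)))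
  r₀ r₁ ≤-refl
  where
  q = stripX (normalize p)

-- The Collatz sequence of a binomial tail

least-true : ∀ (g : ℕ → Bool) w → g w ≡ true →
  ∃[ d ] d ≤ w × g d ≡ true × (∀ j → j < d → g j ≡ false)
least-true g w gw with g 0 in g0
... | true = 0 , z≤n , g0 , λ _ ()
least-true g zero gw | false with trans (sym g0) gw
... | ()
least-true g (suc w) gw | false with least-true (g ∘ suc) w gw
... | d , d≤w , gd , below-d = suc d , s≤s d≤w , gd , λ where
  zero _ → g0
  (suc j) (s≤s j<d) → below-d j j<d

collatz : Poly → Poly
collatz p = oddPart (one ⊕ M ⊗ p)

BinomTail : ℕ → ℕ → Poly
BinomTail m e = drop e (X+1 ^ᵖ m)

coeff-BinomTail : ∀ m e i → coeff (BinomTail m e) i ≡ binom m (e + i)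
coeff-BinomTail m e i = coeff-drop e (X+1 ^ᵖ m) i

coeff-BinomTail-zero : ∀ m e → coeff (BinomTail m e) 0 ≡ binom m e
coeff-BinomTail-zero m e = trans (coeff-BinomTail m e 0) (cong (binom m) (+-identityʳ e))

one⊕X+1⊗BinomTail : ∀ m e → binom m e ≡ true →
  one ⊕ X+1 ⊗ BinomTail m e ≈ X ⊗ BinomTail (suc m) (suc e)
one⊕X+1⊗BinomTail m e me = coeffwise agree
  where
  open ≡-Reasoning
  B = BinomTail m e
  B′ = BinomTail (suc m) (suc e)
  agree : ∀ i → coeff (one ⊕ X+1 ⊗ B) i ≡ coeff (X ⊗ B′) i
  agree zero = begin
    coeff (one ⊕ X+1 ⊗ B) 0
      ≡⟨ coeff-⊕ one (X+1 ⊗ B) 0 ⟩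
    true xor coeff (X+1 ⊗ B) 0
      ≡⟨ cong (true xor_) (trans (coeff-X+1⊗-zero B) (trans (coeff-BinomTail-zero m e) me)) ⟩
    false
      ≡⟨ coeff≡ (X⊗ B′) 0 ⟨
    coeff (X ⊗ B′) 0 ∎
  agree (suc i) = begin
    coeff (one ⊕ X+1 ⊗ B) (suc i)
      ≡⟨ coeff-⊕ one (X+1 ⊗ B) (suc i) ⟩
    coeff (X+1 ⊗ B) (suc i)
      ≡⟨ coeff-X+1⊗-suc B i ⟩
    coeff B (suc i) xor coeff B i
      ≡⟨ cong₂ _xor_ (coeff-BinomTail m e (suc i)) (coeff-BinomTail m e i) ⟩
    binom m (e + suc i) xor binom m (e + i)
      ≡⟨ cong (λ j → binom m j xor binom m (e + i)) (+-suc e i) ⟩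
    binom m (suc (e + i)) xor binom m (e + i) ≡⟨ binom-pascal m (e + i) ⟨
    binom (suc m) (suc e + i)
      ≡⟨ coeff-BinomTail (suc m) (suc e) i ⟨
    coeff B′ i
      ≡⟨ coeff≡ (X⊗ B′) (suc i) ⟨
    coeff (X ⊗ B′) (suc i) ∎

collatz-BinomTail : ∀ {p} m e d → p ≈ φ (BinomTail m e) → binom m e ≡ true →
  binom (suc m) (suc (e + d)) ≡ true → (∀ j → j < d → binom (suc m) (suc (e + j)) ≡ false) →
  collatz p ≈ φ (BinomTail (suc m) (suc (e + d)))
collatz-BinomTail {p} m e d p≈ me top below =
  oddPart-X^a⊗X+1^b⊗ (suc d) (suc d) (one ⊕ M ⊗ p) (φ B″) shape
    (trans (coeff-φ-zero B″) B″₀) (trans (eval1-φ B″) B″₀)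
  where
  B = BinomTail m e
  B′ = BinomTail (suc m) (suc e)
  B″ = BinomTail (suc m) (suc (e + d))
  B″₀ : coeff B″ 0 ≡ true
  B″₀ = trans (coeff-BinomTail-zero (suc m) (suc (e + d))) top
  gap : ∀ j → j < d → coeff B′ j ≡ false
  gap j j<d = trans (coeff-BinomTail (suc m) (suc e) j) (below j j<d)
  shape : one ⊕ M ⊗ p ≈ X ^ᵖ suc d ⊗ (X+1 ^ᵖ suc d ⊗ φ B″)
  shape = begin
    one ⊕ M ⊗ p
      ≈⟨ ⊕-cong (≈-sym φ-one) (⊗-cong (≈-sym φ-X+1) p≈) ⟩
    φ one ⊕ φ X+1 ⊗ φ B
      ≈⟨ ⊕-congʳ (φ one) (φ-⊗ X+1 B) ⟨
    φ one ⊕ φ (X+1 ⊗ B)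
      ≈⟨ φ-⊕ one (X+1 ⊗ B) ⟨
    φ (one ⊕ X+1 ⊗ B)
      ≈⟨ φ-cong (one⊕X+1⊗BinomTail m e me) ⟩
    φ (X ⊗ B′)
      ≈⟨ φ-cong (⊗-congʳ X (≈X^k⊗drop d B′ gap)) ⟩
    φ (X ⊗ (X ^ᵖ d ⊗ drop d B′))
      ≈⟨ φ-cong (⊗-assoc X (X ^ᵖ d) (drop d B′)) ⟨
    φ (X ^ᵖ suc d ⊗ drop d B′)
      ≡⟨ cong (λ q → φ (X ^ᵖ suc d ⊗ q)) (drop-drop (suc e) d (X+1 ^ᵖ suc m)) ⟩
    φ (X ^ᵖ suc d ⊗ B″)
      ≈⟨ φ-X^k⊗ (suc d) B″ ⟩
    X ^ᵖ suc d ⊗ (X+1 ^ᵖ suc d ⊗ φ B″) ∎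
    where open ≈-Reasoning

BinomTail-self : ∀ m → BinomTail m m ≈ one
BinomTail-self m = coeffwise agree
  where
  agree : ∀ i → coeff (BinomTail m m) i ≡ coeff one i
  agree zero = trans (coeff-BinomTail-zero m m) (binom-diag m)
  agree (suc i) =
    trans (coeff-BinomTail m m (suc i)) (binom-high m (m + suc i) (m<m+n m (s≤s z≤n)))

BinomTail-≉one : ∀ {m e} → e < m → ¬ BinomTail m e ≈ one
BinomTail-≉one {m} {e} e<m h
  with m ∸ e | m+[n∸m]≡n (<⇒≤ e<m) | m>n⇒m∸n≢0 e<m | coeff≡ h (m ∸ e)
... | zero | _ | m∸e≢0 | _ = m∸e≢0 refl
... | suc j | e+j≡m | _ | coeff≡false with
  trans (sym coeff≡false)
    (trans (coeff-BinomTail m e (suc j)) (trans (cong (binom m) e+j≡m) (binom-diag m)))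
...   | ()

module Orbit (a : ℕ) where

  H : ℕ
  H = 2 ^ a

  -- The invariant at m = 2^a + s; e ≤ s keeps the sequence away from 1, which needs e = m.
  Invariant : Poly → ℕ → Set
  Invariant p s = ∃[ e ] e ≤ s × binom (H + s) e ≡ true × p ≈ φ (BinomTail (H + s) e)

  -- The next exponent is found below s + 1, since C(2^a + s + 1, s + 1) is odd.
  invariant-step : ∀ {p s} → suc s < H → Invariant p s → Invariant (collatz p) (suc s)
  invariant-step {p} {s} s+1<H (e , e≤s , me , p≈) rewrite +-suc H s
    with least-true (λ j → binom (suc (H + s)) (suc (e + j))) (s ∸ e) s+1-odd
    where
    s+1-odd : binom (suc (H + s)) (suc (e + (s ∸ e))) ≡ true
    s+1-odd = subst₂ (λ n j → binom n (suc j) ≡ true) (+-suc H s) (sym (m+[n∸m]≡n e≤s))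
      (binom-2^+ a (suc s) s+1<H)
  ... | d , d≤s∸e , top , below =
    suc (e + d) , s≤s (≤-trans (+-monoʳ-≤ e d≤s∸e) (≤-reflexive (m+[n∸m]≡n e≤s))) , top ,
    collatz-BinomTail (H + s) e d p≈ me top below

  -- C(2^(a+1), j) is even for 0 < j < 2^(a+1), so from m + 1 = 2^(a+1) the next exponent is m + 1.
  invariant-last-step : ∀ {p s} → suc s ≡ H → Invariant p s → IsOne (collatz p)
  invariant-last-step {p} {s} s+1≡H (e , e≤s , me , p≈) = ≈one⇒IsOne (begin
    collatz p                              ≈⟨ collatz-BinomTail m e d p≈ me top below ⟩
    φ (BinomTail (suc m) (suc (e + d)))    ≡⟨ cong (λ j → φ (BinomTail (suc m) (suc j))) e+d≡m ⟩
    φ (BinomTail (suc m) (suc m))          ≈⟨ φ-cong (BinomTail-self (suc m)) ⟩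
    φ one                                  ≈⟨ φ-one ⟩
    one                                    ∎)
    where
    open ≈-Reasoning
    m = H + s
    d = m ∸ e
    e+d≡m : e + d ≡ m
    e+d≡m = m+[n∸m]≡n (≤-trans e≤s (m≤n+m s H))
    m+1≡2^[a+1] : suc m ≡ 2 ^ suc a
    m+1≡2^[a+1] =
      trans (sym (+-suc H s)) (trans (cong (H +_) s+1≡H) (cong (H +_) (sym (+-identityʳ H))))
    top : binom (suc m) (suc (e + d)) ≡ true
    top = subst (λ j → binom (suc m) (suc j) ≡ true) (sym e+d≡m) (binom-diag (suc m))
    below : ∀ j → j < d → binom (suc m) (suc (e + j)) ≡ false
    below j j<d = subst (λ n → binom n (suc (e + j)) ≡ false) (sym m+1≡2^[a+1])
      (binom-2^ (suc a) (suc (e + j)) (s≤s z≤n)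
        (subst (suc (e + j) <_) m+1≡2^[a+1] (s≤s (subst (e + j <_) e+d≡m (+-monoʳ-< e j<d)))))

  invariant⇒¬IsOne : ∀ {p s} → Invariant p s → ¬ IsOne p
  invariant⇒¬IsOne {p} {s} (e , e≤s , _ , p≈) p-one =
    BinomTail-≉one (≤-<-trans e≤s (m<n+m s (m^n>0 2 a)))
      (φ-injective (≈-trans (≈-sym p≈) (≈-trans (IsOne⇒≈one p-one) (≈-sym φ-one))))

  orbit-invariant : ∀ {A s} → Invariant (odd A 0) s →
    ∀ k → s + k < H → Invariant (odd A k) (s + k)
  orbit-invariant {A} {s} start zero _ = subst (Invariant (odd A 0)) (sym (+-identityʳ s)) start
  orbit-invariant {A} {s} start (suc k) s+k+1<H =
    subst (Invariant (odd A (suc k))) (sym (+-suc s k))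
      (invariant-step (subst (_< H) (+-suc s k) s+k+1<H)
        (orbit-invariant start k (<-trans (+-monoʳ-< s (n<1+n k)) s+k+1<H)))

  collatzLength-invariant : ∀ {A s} → Invariant (odd A 0) s → s < H →
    CollatzLength A (suc (H ∸ s))
  collatzLength-invariant {A} {s} start s<H with H ∸ s | m+[n∸m]≡n (<⇒≤ s<H) | m>n⇒m∸n≢0 s<H
  ... | zero | _ | H∸s≢0 = ⊥-elim (H∸s≢0 refl)
  ... | suc k | s+k+1≡H | _ = suc k , refl ,
    invariant-last-step (trans (sym (+-suc s k)) s+k+1≡H)
      (orbit-invariant start k (below-H (n<1+n k))) ,
    λ j j<k+1 → invariant⇒¬IsOne (orbit-invariant start j (below-H j<k+1))
    where
    below-H : ∀ {j} → j < suc k → s + j < H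
    below-H j<k+1 = subst (s + _ <_) s+k+1≡H (+-monoʳ-< s j<k+1)

-- The starting polynomial

-- tˢ ((1 + t)ⁿ + ⋯ + 1)ˢ = ((1 + t)ⁿ⁺¹ + 1)ˢ = (1 + t)^((n+1) s) + 1 for s = 2^u.
geomSum-BinomTail : ∀ u n → geomSum X+1 n ^ᵖ (2 ^ u) ≈ BinomTail (suc n * 2 ^ u) (2 ^ u)
geomSum-BinomTail u n = begin
  G ^ᵖ S                                  ≈⟨ drop-X^k⊗ S (G ^ᵖ S) ⟨
  drop S (X ^ᵖ S ⊗ G ^ᵖ S)                ≈⟨ drop-cong S (⊗-^ᵖ X G S) ⟨
  drop S ((X ⊗ G) ^ᵖ S)                   ≈⟨ drop-cong S (^ᵖ-cong S (geomSum-telescope X+1 n)) ⟩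
  drop S ((X+1 ^ᵖ suc n ⊕ one) ^ᵖ S)      ≈⟨ drop-cong S (⊕-^ᵖ-2^ u (X+1 ^ᵖ suc n) one) ⟩
  drop S ((X+1 ^ᵖ suc n) ^ᵖ S ⊕ one ^ᵖ S) ≈⟨ drop-cong S (⊕-cong (^ᵖ-* X+1 (suc n) S) (one-^ᵖ S)) ⟩
  drop S (X+1 ^ᵖ (suc n * S) ⊕ one)       ≈⟨ drop-⊕-one (X+1 ^ᵖ (suc n * S)) (m^n>0 2 u) ⟩
  BinomTail (suc n * S) S                 ∎
  where
  open ≈-Reasoning
  S = 2 ^ u
  G = geomSum X+1 n

binom-start : ∀ u v → binom (suc (2 * v) * 2 ^ u) (2 ^ u) ≡ true
binom-start u v = begin
  binom (suc (2 * v) * 2 ^ u) (2 ^ u)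
    ≡⟨ coeff-BinomTail-zero (suc (2 * v) * 2 ^ u) (2 ^ u) ⟨
  coeff (BinomTail (suc (2 * v) * 2 ^ u) (2 ^ u)) 0
    ≡⟨ coeff≡ (geomSum-BinomTail u (2 * v)) 0 ⟨
  coeff (geomSum X+1 (2 * v) ^ᵖ (2 ^ u)) 0
    ≡⟨ coeff-^ᵖ-zero (geomSum X+1 (2 * v)) (2 ^ u) (coeff-geomSum-even v refl) ⟩
  true ∎
  where open ≡-Reasoning

odd-start : ∀ u v →
  odd (geomSum M (2 * v) ^ᵖ (2 ^ u)) 0 ≈ φ (BinomTail (suc (2 * v) * 2 ^ u) (2 ^ u))
odd-start u v = oddPart-X^a⊗X+1^b⊗ 0 0 A (φ B) shape
  (trans (coeff-φ-zero B) B₀) (trans (eval1-φ B) B₀)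
  where
  S = 2 ^ u
  A = geomSum M (2 * v) ^ᵖ S
  B = BinomTail (suc (2 * v) * S) S
  B₀ : coeff B 0 ≡ true
  B₀ = trans (coeff-BinomTail-zero (suc (2 * v) * S) S) (binom-start u v)
  shape : A ≈ one ⊗ (one ⊗ φ B)
  shape = begin
    geomSum M (2 * v) ^ᵖ S              ≈⟨ ^ᵖ-cong S (geomSum-cong (2 * v) (≈-sym φ-X+1)) ⟩
    geomSum (φ X+1) (2 * v) ^ᵖ S        ≈⟨ ^ᵖ-cong S (φ-geomSum X+1 (2 * v)) ⟨
    φ (geomSum X+1 (2 * v)) ^ᵖ S        ≈⟨ φ-^ᵖ (geomSum X+1 (2 * v)) S ⟨
    φ (geomSum X+1 (2 * v) ^ᵖ S)        ≈⟨ φ-cong (geomSum-BinomTail u (2 * v)) ⟩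
    φ B                                 ≈⟨ ≈-trans (⊗-identityˡ _) (⊗-identityˡ (φ B)) ⟨
    one ⊗ (one ⊗ φ B)                   ∎
    where open ≈-Reasoning

initial-offset : ∀ u r′ w → 2 ^ r′ ≤ w → suc w < 2 ^ suc r′ →
  ∃[ s ] 2 ^ (u + r′) + s ≡ suc w * 2 ^ u × 2 ^ u ≤ s × s < 2 ^ (u + r′) ×
         2 ^ (u + r′) ∸ s ≡ 2 ^ u * (2 ^ suc r′ ∸ w ∸ 1)
initial-offset u r′ w c≤w w+1<2c = S * y , H+s≡N , S≤s , s<H , H∸s≡
  where
  open ≡-Reasoning
  S c y : ℕ
  S = 2 ^ u
  c = 2 ^ r′
  y = suc w ∸ c
  H≡S*c : 2 ^ (u + r′) ≡ S * c
  H≡S*c = ^-distribˡ-+-* 2 u r′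
  c+y≡w+1 : c + y ≡ suc w
  c+y≡w+1 = m+[n∸m]≡n (m≤n⇒m≤1+n c≤w)
  H+s≡N : 2 ^ (u + r′) + S * y ≡ suc w * S
  H+s≡N = begin
    2 ^ (u + r′) + S * y   ≡⟨ cong (_+ S * y) H≡S*c ⟩
    S * c + S * y          ≡⟨ *-distribˡ-+ S c y ⟨
    S * (c + y)            ≡⟨ cong (S *_) c+y≡w+1 ⟩
    S * suc w              ≡⟨ *-comm S (suc w) ⟩
    suc w * S              ∎
  S≤s : S ≤ S * y
  S≤s = ≤-trans (≤-reflexive (sym (*-identityʳ S))) (*-monoʳ-≤ S (m<n⇒0<n∸m (s≤s c≤w)))
  y<c : y < c
  y<c = +-cancelˡ-< c y c (subst₂ _<_ (sym c+y≡w+1) (cong (c +_) (+-identityʳ c)) w+1<2c)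
  s<H : S * y < 2 ^ (u + r′)
  s<H = subst (S * y <_) (sym H≡S*c) (*-monoʳ-< S {{m^n≢0 2 u}} y<c)
  H∸s≡ : 2 ^ (u + r′) ∸ S * y ≡ S * (2 ^ suc r′ ∸ w ∸ 1)
  H∸s≡ = begin
    2 ^ (u + r′) ∸ S * y
      ≡⟨ cong (_∸ S * y) H≡S*c ⟩
    S * c ∸ S * y
      ≡⟨ *-distribˡ-∸ S c y ⟨
    S * (c ∸ y)
      ≡⟨ cong (S *_) (sym ([m+n]∸[m+o]≡n∸o c c y)) ⟩
    S * (c + c ∸ (c + y))
      ≡⟨ cong₂ (λ m n → S * (m ∸ n)) (cong (c +_) (sym (+-identityʳ c))) c+y≡w+1 ⟩
    S * (2 * c ∸ suc w)
      ≡⟨ cong (λ n → S * (2 * c ∸ n)) (+-comm 1 w) ⟩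
    S * (2 * c ∸ (w + 1))
      ≡⟨ cong (S *_) (∸-+-assoc (2 * c) w 1) ⟨
    S * (2 * c ∸ w ∸ 1) ∎

corollary3p5 : (u v : ℕ) → 1 ≤ u → 1 ≤ v → (r : ℕ) → 2 * v < 2 ^ r →
    (∀ s → 2 * v < 2 ^ s → r ≤ s) →
    CollatzLength ((geomSum M (2 * v)) ^ᵖ (2 ^ u)) (2 ^ u * (2 ^ r ∸ 2 * v ∸ 1) + 1)
corollary3p5 u zero _ () r _ _
corollary3p5 u (suc v) _ _ zero (s≤s ()) _
corollary3p5 u v _ _ (suc r′) 2v<2^r r-least
  with initial-offset u r′ (2 * v) 2^r′≤2v 2v+1<2^r
  where
  2^r′≤2v : 2 ^ r′ ≤ 2 * v
  2^r′≤2v = ≮⇒≥ (λ 2v<2^r′ → 1+n≰n (r-least r′ 2v<2^r′))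
  2v+1<2^r : suc (2 * v) < 2 ^ suc r′
  2v+1<2^r = ≤∧≢⇒< 2v<2^r (λ eq → even≢odd (2 ^ r′) v (sym eq))
... | s , H+s≡N , 2^u≤s , s<H , H∸s≡ =
  subst (CollatzLength A) (trans (cong suc H∸s≡) (+-comm 1 _)) (collatzLength-invariant start s<H)
  where
  open Orbit (u + r′)
  A = geomSum M (2 * v) ^ᵖ (2 ^ u)
  start : Invariant (odd A 0) s
  start = 2 ^ u , 2^u≤s ,
    subst (λ n → binom n (2 ^ u) ≡ true) (sym H+s≡N) (binom-start u v) ,
    subst (λ n → odd A 0 ≈ φ (BinomTail n (2 ^ u))) (sym H+s≡N) (odd-start u v)
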